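{- Let $G=(V,E)$ be a connected chordal claw-free graph with clique tree $T_G=(\mathcal M,\mathcal E)$, and let $v,w\in V$. If the paths $T_G[\mathcal M_v]$ and $T_G[\mathcal M_w]$ fork, then $T_G[\mathcal M_v]$ and $T_G[\mathcal M_w]$ are paths of length 3 (i.e. each consists of exactly three max cliques).
   Context: Graphs are finite simple undirected. A graph is chordal if every cycle of length at least 4 has a chord, and claw-free if it has no induced $K_{1,3}$. A max clique is an inclusion-maximal clique; $\mathcal M$ is the set of max cliques and $\mathcal M_v$ the set of max cliques containing $v$. A clique tree is a tree on $\mathcal M$ in which each $T[\mathcal M_v]$ is connected; a connected chordal claw-free graph has exactly one clique tree $T_G$, and each $T_G[\mathcal M_v]$ is a path. The length of a path is its number of vertices. For paths $P,Q$ in $T_G$, a triple $(A',A,\{A_P,A_Q\})$ is a fork of $P$ and $Q$ if $P[\{A',A,A_P\}]$ and $Q[\{A',A,A_Q\}]$ are induced subpaths of $P$ and $Q$ with three vertices each (with $A$ in the middle), $A_P$ does not occur in $Q$ and $A_Q$ does not occur in $P$. $P$ and $Q$ fork (in $A$) if such a fork exists. -}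

module Defs where

open import Data.Nat using (ℕ; zero; suc; _≤_)
open import Data.Fin using (Fin; zero; suc; toℕ; inject₁; fromℕ)
open import Data.Fin.Subset using (Subset; _∈_; _∉_; _⊆_)
open import Data.Product using (Σ; ∃; _×_; _,_)
open import Data.Sum using (_⊎_)
open import Data.Empty using (⊥)
open import Relation.Nullary using (¬_)
open import Relation.Binary.PropositionalEquality using (_≡_; _≢_)
open import Relation.Binary.Construct.Closure.ReflexiveTransitive using (Star)

record Graph (n : ℕ) : Set₁ where
  field
    Adj     : Fin n → Fin n → Set
    sym     : ∀ {x y} → Adj x y → Adj y x
    irrefl  : ∀ {x} → ¬ Adj x x
open Graph public

record IsCycle {X : Set} (R : X → X → Set) (m : ℕ) (c : Fin (suc m) → X) : Set where
  field
    distinct : ∀ i j → c i ≡ c j → i ≡ j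
    step     : ∀ (i : Fin m) → R (c (inject₁ i)) (c (suc i))
    close    : R (c (fromℕ m)) (c zero)

CyclicNeighbours : (m : ℕ) → Fin (suc m) → Fin (suc m) → Set
CyclicNeighbours m i j =
  toℕ j ≡ suc (toℕ i) ⊎ toℕ i ≡ suc (toℕ j)
  ⊎ (toℕ i ≡ 0 × toℕ j ≡ m) ⊎ (toℕ i ≡ m × toℕ j ≡ 0)

-- Chordal: every cycle of length ≥ 4 has a chord.
Chordal : ∀ {n} → Graph n → Set
Chordal {n} G = ∀ (m : ℕ) (c : Fin (suc m) → Fin n) → 3 ≤ m →
  IsCycle (Adj G) m c →
  ∃ λ i → ∃ λ j → i ≢ j × ¬ CyclicNeighbours m i j × Adj G (c i) (c j)

ClawFree : ∀ {n} → Graph n → Set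
ClawFree {n} G = ¬ (Σ (Fin n) λ u → Σ (Fin n) λ a → Σ (Fin n) λ b → Σ (Fin n) λ c →
  Adj G u a × Adj G u b × Adj G u c ×
  a ≢ b × a ≢ c × b ≢ c ×
  ¬ Adj G a b × ¬ Adj G a c × ¬ Adj G b c)

Connected : ∀ {n} → Graph n → Set
Connected {n} G = ∀ (x y : Fin n) → Star (Adj G) x y

Clique : ∀ {n} → Graph n → Subset n → Set
Clique G C = ∀ x y → x ∈ C → y ∈ C → x ≢ y → Adj G x y

MaxClique : ∀ {n} → Graph n → Subset n → Set
MaxClique {n} G C = Clique G C × (∀ (D : Subset n) → Clique G D → C ⊆ D → D ⊆ C)

record IsCliqueTree {n} (G : Graph n) (TE : Subset n → Subset n → Set) : Set where
  field
    edge-max    : ∀ {A B} → TE A B → MaxClique G A × MaxClique G B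
    edge-sym    : ∀ {A B} → TE A B → TE B A
    edge-irrefl : ∀ {A} → ¬ TE A A
    connected   : ∀ A B → MaxClique G A → MaxClique G B → Star TE A B
    acyclic     : ∀ (m : ℕ) (c : Fin (suc m) → Subset n) → 2 ≤ m → ¬ IsCycle TE m c
    subtree     : ∀ (v : Fin n) A B → MaxClique G A → MaxClique G B → v ∈ A → v ∈ B →
                  Star (λ X Y → TE X Y × v ∈ X × v ∈ Y) A B

InducedP3 : ∀ {n} (TE : Subset n → Subset n → Set) (v : Fin n) (A' A A'' : Subset n) → Set
InducedP3 TE v A' A A'' =
  v ∈ A' × v ∈ A × v ∈ A'' × TE A' A × TE A A'' × A' ≢ A'' × ¬ TE A' A''

IsFork : ∀ {n} (TE : Subset n → Subset n → Set) (v w : Fin n) (A' A AP AQ : Subset n) → Set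
IsFork TE v w A' A AP AQ =
  InducedP3 TE v A' A AP × InducedP3 TE w A' A AQ × w ∉ AP × v ∉ AQ

Fork : ∀ {n} (TE : Subset n → Subset n → Set) (v w : Fin n) → Set
Fork TE v w = ∃ λ A' → ∃ λ A → ∃ λ AP → ∃ λ AQ → IsFork TE v w A' A AP AQ

ExactlyThreeMaxCliques : ∀ {n} → Graph n → Fin n → Set
ExactlyThreeMaxCliques {n} G v = ∃ λ A → ∃ λ B → ∃ λ C →
  MaxClique G A × MaxClique G B × MaxClique G C ×
  v ∈ A × v ∈ B × v ∈ C × A ≢ B × A ≢ C × B ≢ C ×
  (∀ (D : Subset n) → MaxClique G D → v ∈ D → D ≡ A ⊎ D ≡ B ⊎ D ≡ C)

module Submission where

-- The proof rests on one separation principle for clique trees: every tree edge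
-- X–Y is a bridge, so a vertex lying strictly on X's side of it and a vertex
-- lying strictly on Y's side are distinct and non-adjacent (an edge between them
-- would lie in a max clique on both sides).  Claw-freeness is then applied to
-- triples of pairwise separated vertices around a common neighbour.
-- Connectivity and chordality enter only through the given clique tree.

open import Defs
open import Level using (0ℓ)
open import Data.Nat using (ℕ; zero; suc; s≤s; z≤n)
open import Data.Fin using (Fin; zero; suc; inject₁; fromℕ)
open import Data.Fin.Properties using (any?; all?; suc-injective; ¬∀⟶∃¬; sequence) renaming (_≟_ to _≟F_)
open import Data.Fin.Subset using (Subset; _∈_; _∉_; _⊆_; ⁅_⁆; _∪_)
open import Data.Fin.Subset.Properties using (_∈?_; ⊆-antisym; x∈⁅x⁆; x∈⁅y⁆⇒x≡y; p⊆p∪q; q⊆p∪q; x∈p∪q⁻)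
open import Data.Bool.Properties using () renaming (_≟_ to _≟B_)
open import Data.Vec using (Vec; []; _∷_; lookup)
open import Data.Vec.Properties using (≡-dec)
open import Data.List using (List; []; _∷_; allFin)
open import Data.List.Relation.Unary.Any using (here; there)
import Data.List.Membership.Propositional as List
open import Data.List.Membership.Propositional.Properties using (∈-allFin)
open import Data.Product using (∃; ∃₂; _×_; _,_; proj₁; proj₂)
open import Data.Sum using (_⊎_; inj₁; inj₂)
open import Data.Empty using (⊥; ⊥-elim)
open import Effect.Applicative using (RawApplicative)
open import Effect.Monad using (RawMonad)
open import Relation.Nullary using (¬_; Dec; yes; no; contradiction)
open import Relation.Nullary.Decidable using (_→-dec_; _⊎-dec_; ¬?; decidable-stable; ¬¬-excluded-middle)
open import Relation.Nullary.Negation using (¬¬-Monad; DoubleNegation)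
open import Relation.Unary using (Decidable)
open import Relation.Binary using (Rel)
open import Relation.Binary.Definitions using (DecidableEquality)
open import Relation.Binary.PropositionalEquality using (_≡_; _≢_; refl; trans; subst; cong; ≢-sym) renaming (sym to ≡-sym)
open import Relation.Binary.Construct.Closure.ReflexiveTransitive using (Star; ε; _◅_; _◅◅_; reverse)
import Relation.Binary.Construct.Closure.ReflexiveTransitive as Star

_≟S_ : ∀ {n} → DecidableEquality (Subset n)
_≟S_ = ≡-dec _≟B_

crossing : ∀ {A : Set} {R : Rel A 0ℓ} {P : A → Set} → Decidable P →
           ∀ {x y} → Star R x y → ¬ P x → P y → ∃₂ λ a b → R a b × ¬ P a × P b
crossing P? ε ¬Px Py = contradiction Py ¬Px
crossing P? (_◅_ {j = z} r rs) ¬Px Py with P? z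
... | yes Pz = _ , _ , r , ¬Px , Pz
... | no ¬Pz = crossing P? rs ¬Pz Py

-- Paths in a relation over a type with decidable equality.  A walk is indexed
-- by its vertex list so that a walk without repetitions can be read as a cycle.
module Paths {A : Set} (_≟_ : DecidableEquality A) (R : Rel A 0ℓ) where

  data Walk : A → A → (m : ℕ) → Vec A (suc m) → Set where
    done : ∀ {y} → Walk y y 0 (y ∷ [])
    _▸_  : ∀ {x z y m zs} → R x z → Walk z y m zs → Walk x y (suc m) (x ∷ zs)

  Distinct : ∀ {k} → Vec A k → Set
  Distinct zs = ∀ i j → lookup zs i ≡ lookup zs j → i ≡ j

  Path : A → A → Set
  Path x y = ∃₂ λ m zs → Walk x y m zs × Distinct zs

  distinct-tail : ∀ {k x} {zs : Vec A k} → Distinct (x ∷ zs) → Distinct zs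
  distinct-tail d i j eq = suc-injective (d (suc i) (suc j) eq)

  distinct-cons : ∀ {k x} {zs : Vec A k} → ¬ (∃ λ i → lookup zs i ≡ x) → Distinct zs → Distinct (x ∷ zs)
  distinct-cons x∉ d zero    zero    _  = refl
  distinct-cons x∉ d zero    (suc j) eq = contradiction (j , ≡-sym eq) x∉
  distinct-cons x∉ d (suc i) zero    eq = contradiction (i , eq) x∉
  distinct-cons x∉ d (suc i) (suc j) eq = cong suc (d i j eq)

  suffix : ∀ {x y m zs} → Walk x y m zs → Distinct zs → ∀ i → Path (lookup zs i) y
  suffix done    d zero    = _ , _ , done , d
  suffix (r ▸ p) d zero    = _ , _ , r ▸ p , d
  suffix (r ▸ p) d (suc i) = suffix p (distinct-tail d) i

  -- Every walk shortens to a path: prepend x, or cut back to an earlier visit of x.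
  to-path : ∀ {x y} → Star R x y → Path x y
  to-path ε = 0 , _ , done , λ { zero zero _ → refl }
  to-path {x} {y} (r ◅ rs) with to-path rs
  ... | m , zs , p , d with any? (λ i → lookup zs i ≟ x)
  ... | yes (i , zsᵢ≡x) = subst (λ t → Path t y) zsᵢ≡x (suffix p d i)
  ... | no x∉zs = suc m , x ∷ zs , r ▸ p , distinct-cons x∉zs d

  walk-step : ∀ {x y m zs} → Walk x y m zs → ∀ (i : Fin m) → R (lookup zs (inject₁ i)) (lookup zs (suc i))
  walk-step (r ▸ done)    zero    = r
  walk-step (r ▸ (_ ▸ _)) zero    = r
  walk-step (_ ▸ p)       (suc i) = walk-step p i

  walk-end : ∀ {x y m zs} → Walk x y m zs → lookup zs (fromℕ m) ≡ y
  walk-end done    = refl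
  walk-end (_ ▸ p) = walk-end p

-- Adjacency need not be decidable, but it is so up to double negation, which
-- suffices whenever the goal is a negation.
¬¬-decidable-adjacency : ∀ {n} (G : Graph n) → ¬ ¬ (∀ i j → Dec (Adj G i j))
¬¬-decidable-adjacency G = sequence ¬¬-applicative λ i → sequence ¬¬-applicative λ j → ¬¬-excluded-middle
  where
  ¬¬-applicative : RawApplicative {0ℓ} DoubleNegation
  ¬¬-applicative = RawMonad.rawApplicative ¬¬-Monad

Joins : ∀ {n} → Graph n → Fin n → Subset n → Set
Joins G i S = ∀ s → s ∈ S → s ≢ i → Adj G i s

insert-clique : ∀ {n} (G : Graph n) {i S} → Joins G i S → Clique G S → Clique G (⁅ i ⁆ ∪ S)
insert-clique G {i} {S} joins S-clique x y x∈ y∈ x≢y = by-cases (x∈p∪q⁻ ⁅ i ⁆ S x∈) (x∈p∪q⁻ ⁅ i ⁆ S y∈)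
  where
  by-cases : x ∈ ⁅ i ⁆ ⊎ x ∈ S → y ∈ ⁅ i ⁆ ⊎ y ∈ S → Adj G x y
  by-cases (inj₁ x≡) (inj₁ y≡) = contradiction (trans (x∈⁅y⁆⇒x≡y i x≡) (≡-sym (x∈⁅y⁆⇒x≡y i y≡))) x≢y
  by-cases (inj₁ x≡) (inj₂ yS) = subst (λ t → Adj G t y) (≡-sym x≡i) (joins y yS λ y≡i → x≢y (trans x≡i (≡-sym y≡i)))
    where
    x≡i : x ≡ i
    x≡i = x∈⁅y⁆⇒x≡y i x≡
  by-cases (inj₂ xS) (inj₁ y≡) = subst (Adj G x) (≡-sym y≡i) (sym G (joins x xS λ x≡i → x≢y (trans x≡i (≡-sym y≡i))))
    where
    y≡i : y ≡ i
    y≡i = x∈⁅y⁆⇒x≡y i y≡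
  by-cases (inj₂ xS) (inj₂ yS) = S-clique x y xS yS x≢y

-- With decidable adjacency every clique extends to a max clique: scan all
-- vertices once, admitting each one that is adjacent to everything admitted so far.
module MaximalExtension {n} (G : Graph n) (adj? : ∀ i j → Dec (Adj G i j)) where

  joins? : ∀ i S → Dec (Joins G i S)
  joins? i S = all? λ s → (s ∈? S) →-dec (¬? (s ≟F i) →-dec adj? i s)

  admit : Fin n → Subset n → Subset n
  admit i S with joins? i S
  ... | yes _ = ⁅ i ⁆ ∪ S
  ... | no _  = S

  saturate : List (Fin n) → Subset n → Subset n
  saturate []       S = S
  saturate (i ∷ is) S = saturate is (admit i S)

  admit-⊇ : ∀ i S → S ⊆ admit i S
  admit-⊇ i S x∈ with joins? i S
  ... | yes _ = q⊆p∪q ⁅ i ⁆ S x∈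
  ... | no _  = x∈

  saturate-⊇ : ∀ is S → S ⊆ saturate is S
  saturate-⊇ []       S x∈ = x∈
  saturate-⊇ (i ∷ is) S x∈ = saturate-⊇ is (admit i S) (admit-⊇ i S x∈)

  admit-clique : ∀ i S → Clique G S → Clique G (admit i S)
  admit-clique i S S-clique with joins? i S
  ... | yes joins = insert-clique G joins S-clique
  ... | no _      = S-clique

  saturate-clique : ∀ is S → Clique G S → Clique G (saturate is S)
  saturate-clique []       S S-clique = S-clique
  saturate-clique (i ∷ is) S S-clique = saturate-clique is (admit i S) (admit-clique i S S-clique)

  saturate-complete : ∀ is S i → i List.∈ is → Joins G i (saturate is S) → i ∈ saturate is S
  saturate-complete (j ∷ is) S i (there i∈is) joins = saturate-complete is (admit j S) i i∈is joins
  saturate-complete (j ∷ is) S .j (here refl) joins with joins? j S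
  ... | yes _     = saturate-⊇ is _ (p⊆p∪q S (x∈⁅x⁆ j))
  ... | no ¬joins = contradiction (λ s s∈S s≢j → joins s (saturate-⊇ is S s∈S) s≢j) ¬joins

  extend-to-max : ∀ {S} → Clique G S → ∃ λ E → MaxClique G E × S ⊆ E
  extend-to-max {S} S-clique = E , (saturate-clique vertices S S-clique , maximal) , saturate-⊇ vertices S
    where
    vertices : List (Fin n)
    vertices = allFin n
    E : Subset n
    E = saturate vertices S
    maximal : ∀ D → Clique G D → E ⊆ D → D ⊆ E
    maximal D D-clique E⊆D {i} i∈D = saturate-complete vertices S i (∈-allFin i)
      λ s s∈E s≢i → D-clique i s i∈D (E⊆D s∈E) (λ i≡s → s≢i (≡-sym i≡s))

edge-in-max-clique : ∀ {n} (G : Graph n) → (∀ i j → Dec (Adj G i j)) →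
                     ∀ {x y} → Adj G x y → ∃ λ E → MaxClique G E × x ∈ E × y ∈ E
edge-in-max-clique G adj? {x} {y} xy with extend-to-max (insert-clique G joins singleton)
  where
  open MaximalExtension G adj?
  joins : Joins G x ⁅ y ⁆
  joins s s∈ _ rewrite x∈⁅y⁆⇒x≡y y s∈ = xy
  singleton : Clique G ⁅ y ⁆
  singleton s t s∈ t∈ s≢t = contradiction (trans (x∈⁅y⁆⇒x≡y y s∈) (≡-sym (x∈⁅y⁆⇒x≡y y t∈))) s≢t
... | E , E-max , pair⊆E = E , E-max , pair⊆E (p⊆p∪q ⁅ y ⁆ (x∈⁅x⁆ x)) , pair⊆E (q⊆p∪q ⁅ x ⁆ ⁅ y ⁆ (x∈⁅x⁆ y))

module CliqueTreeFacts {n} {G : Graph n} {TE : Subset n → Subset n → Set} (ct : IsCliqueTree G TE) where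
  open IsCliqueTree ct

  edge-≢ : ∀ {X Y} → TE X Y → X ≢ Y
  edge-≢ {X} e X≡Y = edge-irrefl (subst (TE X) (≡-sym X≡Y) e)

  source-max : ∀ {X Y} → TE X Y → MaxClique G X
  source-max e = proj₁ (edge-max e)

  target-max : ∀ {X Y} → TE X Y → MaxClique G Y
  target-max e = proj₂ (edge-max e)

  OtherThan : Subset n → Subset n → Rel (Subset n) 0ℓ
  OtherThan X Y P Q = TE P Q × ¬ (P ≡ X × Q ≡ Y) × ¬ (P ≡ Y × Q ≡ X)

  module _ {X Y : Subset n} (e : TE X Y) where
    open Paths _≟S_ (OtherThan X Y)

    -- A path from X to Y along other edges, closed up by the edge Y–X, is a cycle.
    path-closes : ∀ {m zs} → Walk X Y m zs → Distinct zs → ⊥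
    path-closes done                  _        = edge-irrefl e
    path-closes (r ▸ done)            _        = proj₁ (proj₂ r) (refl , refl)
    path-closes {suc (suc m)} {zs} p@(_ ▸ (_ ▸ _)) distinct =
      acyclic (suc (suc m)) (lookup zs) (s≤s (s≤s z≤n)) record
        { distinct = distinct
        ; step     = λ i → proj₁ (walk-step p i)
        ; close    = subst (λ Z → TE Z X) (≡-sym (walk-end p)) (edge-sym e) }

    bridge : ¬ Star (OtherThan X Y) X Y
    bridge walk with to-path walk
    ... | _ , _ , p , distinct = path-closes p distinct

  OnSide : Subset n → Subset n → Subset n → Set
  OnSide X Y = Star (λ P Q → TE P Q × P ≢ Y × Q ≢ Y) X

  sides-disjoint : ∀ {X Y Z} → TE X Y → OnSide X Y Z → OnSide Y X Z → ⊥
  sides-disjoint {X} {Y} e X⇝Z Y⇝Z = bridge e (Star.map avoid-Y X⇝Z ◅◅ reverse avoid-X-reversed Y⇝Z)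
    where
    avoid-Y : ∀ {P Q} → TE P Q × P ≢ Y × Q ≢ Y → OtherThan X Y P Q
    avoid-Y (t , P≢Y , Q≢Y) = t , (λ (_ , Q≡Y) → Q≢Y Q≡Y) , (λ (P≡Y , _) → P≢Y P≡Y)
    avoid-X-reversed : ∀ {P Q} → TE P Q × P ≢ X × Q ≢ X → OtherThan X Y Q P
    avoid-X-reversed (t , P≢X , Q≢X) = edge-sym t , (λ (Q≡X , _) → Q≢X Q≡X) , (λ (_ , P≡X) → P≢X P≡X)

  side-neighbour : ∀ {X Y Z} → TE X Y → TE X Z → Z ≢ Y → OnSide X Y Z
  side-neighbour eXY eXZ Z≢Y = (eXZ , edge-≢ eXY , Z≢Y) ◅ ε

  -- A vertex outside Y spreads the side of Y it occupies over all its max cliques,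
  -- since T[𝓜_x] is connected and avoids Y.
  side-spread : ∀ {X Y Z₀ Z x} → OnSide X Y Z₀ → MaxClique G Z₀ → MaxClique G Z →
                x ∈ Z₀ → x ∈ Z → x ∉ Y → OnSide X Y Z
  side-spread {Y = Y} {x = x} X⇝Z₀ Z₀-max Z-max x∈Z₀ x∈Z x∉Y =
    X⇝Z₀ ◅◅ Star.map avoid-Y (subtree x _ _ Z₀-max Z-max x∈Z₀ x∈Z)
    where
    avoid-Y : ∀ {P Q} → TE P Q × x ∈ P × x ∈ Q → TE P Q × P ≢ Y × Q ≢ Y
    avoid-Y (t , x∈P , x∈Q) = t , (λ P≡Y → x∉Y (subst (x ∈_) P≡Y x∈P)) , (λ Q≡Y → x∉Y (subst (x ∈_) Q≡Y x∈Q))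

  running-intersection : ∀ {B A C z} → TE B A → TE A C → B ≢ C → z ∈ B → z ∈ C → z ∈ A
  running-intersection {B} {A} {C} {z} eBA eAC B≢C z∈B z∈C with z ∈? A
  ... | yes z∈A = z∈A
  ... | no z∉A  = ⊥-elim (sides-disjoint eBA
        (side-spread ε (source-max eBA) (target-max eAC) z∈B z∈C z∉A)
        (side-neighbour (edge-sym eBA) eAC (≢-sym B≢C)))

  Beyond : Subset n → Subset n → Fin n → Set
  Beyond X Y x = x ∉ Y × ∃ λ Z → MaxClique G Z × x ∈ Z × OnSide X Y Z

  beyond-reaches : ∀ {X Y Z x} → Beyond X Y x → MaxClique G Z → x ∈ Z → OnSide X Y Z
  beyond-reaches (x∉Y , _ , Z₀-max , x∈Z₀ , X⇝Z₀) Z-max x∈Z = side-spread X⇝Z₀ Z₀-max Z-max x∈Z₀ x∈Z x∉Y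

  beyond-here : ∀ {X Y x} → TE X Y → x ∈ X → x ∉ Y → Beyond X Y x
  beyond-here e x∈X x∉Y = x∉Y , _ , source-max e , x∈X , ε

  beyond-next : ∀ {Z X Y x} → TE Z X → TE X Y → Z ≢ Y → x ∈ Z → x ∉ X → Beyond X Y x
  beyond-next eZX eXY Z≢Y x∈Z x∉X =
    (λ x∈Y → x∉X (running-intersection eZX eXY Z≢Y x∈Z x∈Y)) ,
    _ , source-max eZX , x∈Z , side-neighbour eXY (edge-sym eZX) Z≢Y

  Separated : Fin n → Fin n → Set
  Separated x y = ¬ Adj G x y × x ≢ y

  -- The separation principle: vertices beyond opposite ends of a tree edge are
  -- distinct and non-adjacent, since a max clique containing both (one exists
  -- for an edge xy, and for x = y) would lie on both sides.
  separated : ∀ {X Y x y} → TE X Y → Beyond X Y x → Beyond Y X y → Separated x y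
  separated {x = x} {y} e x-beyond y-beyond@(_ , _ , Z-max , y∈Z , _) = non-adjacent , distinct
    where
    on-both-sides : ∀ {Z} → MaxClique G Z → x ∈ Z → y ∈ Z → ⊥
    on-both-sides Z-max x∈Z y∈Z =
      sides-disjoint e (beyond-reaches x-beyond Z-max x∈Z) (beyond-reaches y-beyond Z-max y∈Z)
    non-adjacent : ¬ Adj G x y
    non-adjacent xy = ¬¬-decidable-adjacency G λ adj? →
      let (E , E-max , x∈E , y∈E) = edge-in-max-clique G adj? xy in on-both-sides E-max x∈E y∈E
    distinct : x ≢ y
    distinct refl = on-both-sides Z-max y∈Z y∈Z

  separated-edge : ∀ {X Y x y} → TE X Y → x ∈ X → x ∉ Y → y ∈ Y → y ∉ X → Separated x y
  separated-edge e x∈X x∉Y y∈Y y∉X = separated e (beyond-here e x∈X x∉Y) (beyond-here (edge-sym e) y∈Y y∉X)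

  separated-around : ∀ {B C A x y} → TE B A → TE C A → B ≢ C → x ∈ B → x ∉ A → y ∈ C → y ∉ A → Separated x y
  separated-around eBA eCA B≢C x∈B x∉A y∈C y∉A =
    separated eBA (beyond-here eBA x∈B x∉A) (beyond-next eCA (edge-sym eBA) (≢-sym B≢C) y∈C y∉A)

  separated-across : ∀ {D B A C x y} → TE D B → TE B A → TE C A → D ≢ A → C ≢ B →
                     x ∈ D → x ∉ B → y ∈ C → y ∉ A → Separated x y
  separated-across eDB eBA eCA D≢A C≢B x∈D x∉B y∈C y∉A =
    separated eBA (beyond-next eDB eBA D≢A x∈D x∉B) (beyond-next eCA (edge-sym eBA) C≢B y∈C y∉A)

  -- The ends of a tree edge are distinct max cliques, so each has a private vertex.
  private-vertex : ∀ {X Y} → TE X Y → ∃ λ x → x ∈ X × x ∉ Y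
  private-vertex {X} {Y} e with ¬∀⟶∃¬ n (λ i → i ∈ X → i ∈ Y) (λ i → (i ∈? X) →-dec (i ∈? Y)) X⊈Y
    where
    X⊈Y : ¬ (∀ i → i ∈ X → i ∈ Y)
    X⊈Y X⊆Y = edge-≢ e (⊆-antisym (X⊆Y _) (proj₂ (source-max e) Y (proj₁ (target-max e)) (X⊆Y _)))
  ... | x , x∈X⇏x∈Y = x , decidable-stable (x ∈? X) (λ x∉X → x∈X⇏x∈Y (λ x∈X → contradiction x∈X x∉X)) ,
                          (λ x∈Y → x∈X⇏x∈Y (λ _ → x∈Y))

module ClawFreeCliqueTree {n} {G : Graph n} {TE : Subset n → Subset n → Set}
                          (ct : IsCliqueTree G TE) (claw-free : ClawFree G) where
  open IsCliqueTree ct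
  open CliqueTreeFacts ct

  no-claw : ∀ {u a b c} → Adj G u a → Adj G u b → Adj G u c →
            Separated a b → Separated a c → Separated b c → ⊥
  no-claw ua ub uc (¬ab , a≢b) (¬ac , a≢c) (¬bc , b≢c) =
    claw-free (_ , _ , _ , _ , ua , ub , uc , a≢b , a≢c , b≢c , ¬ab , ¬ac , ¬bc)

  adjacent : ∀ {X S u a} → MaxClique G X → u ∈ X → a ∈ X → u ∈ S → a ∉ S → Adj G u a
  adjacent X-max u∈X a∈X u∈S a∉S = proj₁ X-max _ _ u∈X a∈X (λ { refl → a∉S u∈S })

  -- No vertex lies in a clique A and in three of its tree neighbours: it would
  -- centre a claw with private vertices of the three neighbours.
  three-neighbours : ∀ {A B C D z} → TE B A → TE C A → TE D A → B ≢ C → B ≢ D → C ≢ D →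
                     z ∈ A → z ∈ B → z ∈ C → z ∈ D → ⊥
  three-neighbours eBA eCA eDA B≢C B≢D C≢D z∈A z∈B z∈C z∈D
    with private-vertex eBA | private-vertex eCA | private-vertex eDA
  ... | b , b∈B , b∉A | c , c∈C , c∉A | d , d∈D , d∉A =
    no-claw (adjacent (source-max eBA) z∈B b∈B z∈A b∉A)
            (adjacent (source-max eCA) z∈C c∈C z∈A c∉A)
            (adjacent (source-max eDA) z∈D d∈D z∈A d∉A)
            (separated-around eBA eCA B≢C b∈B b∉A c∈C c∉A)
            (separated-around eBA eDA B≢D b∈B b∉A d∈D d∉A)
            (separated-around eCA eDA C≢D c∈C c∉A d∈D d∉A)

  -- On a subpath B–A–C of T[𝓜_v] we have A ⊆ B ∪ C: a vertex of A outside B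
  -- and C would centre a claw at v with private vertices of B and C.
  middle-covered : ∀ {B A C v a} → TE B A → TE A C → B ≢ C →
                   v ∈ B → v ∈ A → v ∈ C → a ∈ A → a ∉ B → a ∈ C
  middle-covered {C = C} {a = a} eBA eAC B≢C v∈B v∈A v∈C a∈A a∉B with a ∈? C
  ... | yes a∈C = a∈C
  ... | no a∉C with private-vertex eBA | private-vertex (edge-sym eAC)
  ... | b , b∈B , b∉A | c , c∈C , c∉A = ⊥-elim (no-claw
        (adjacent (source-max eBA) v∈B b∈B v∈A b∉A)
        (adjacent (target-max eBA) v∈A a∈A v∈B a∉B)
        (adjacent (target-max eAC) v∈C c∈C v∈A c∉A)
        (separated-edge eBA b∈B b∉A a∈A a∉B)
        (separated-around eBA (edge-sym eAC) B≢C b∈B b∉A c∈C c∉A)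
        (separated-edge eAC a∈A a∉C c∈C c∉A))

  -- Take y ∈ B \ D (so y ∈ A); wherever y and u lie, a claw appears.
  prolonged-claw : ∀ {D B A C₁ C₂ v u} → TE D B → TE B A → TE C₁ A → TE C₂ A →
                   D ≢ A → B ≢ C₁ → B ≢ C₂ → C₁ ≢ C₂ →
                   v ∈ D → v ∈ B → v ∈ A → v ∈ C₁ → u ∈ B → u ∈ A → u ∈ C₂ → u ∉ C₁ → ⊥
  prolonged-claw {D} {B} {A} {C₁} {C₂} {v} {u} eDB eBA eC₁A eC₂A D≢A B≢C₁ B≢C₂ C₁≢C₂
                 v∈D v∈B v∈A v∈C₁ u∈B u∈A u∈C₂ u∉C₁
    with private-vertex eDB | private-vertex (edge-sym eDB) | private-vertex eC₁A | private-vertex eC₂A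
  ... | d , d∈D , d∉B | y , y∈B , y∉D | c , c∈C₁ , c∉A | q , q∈C₂ , q∉A =
    by-cases (y ∈? C₁) (y ∈? C₂) (u ∈? D)
    where
    y∈A : y ∈ A
    y∈A = middle-covered eDB eBA D≢A v∈D v∈B v∈A y∈B y∉D
    vd : Adj G v d
    vd = adjacent (source-max eDB) v∈D d∈D v∈B d∉B
    vc : Adj G v c
    vc = adjacent (source-max eC₁A) v∈C₁ c∈C₁ v∈A c∉A
    d-c : Separated d c
    d-c = separated-across eDB eBA eC₁A D≢A (≢-sym B≢C₁) d∈D d∉B c∈C₁ c∉A
    by-cases : Dec (y ∈ C₁) → Dec (y ∈ C₂) → Dec (u ∈ D) → ⊥
    by-cases (no y∉C₁) _ _ =
      no-claw vd vc (adjacent (target-max eDB) v∈B y∈B v∈D y∉D)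
        d-c (separated-edge eDB d∈D d∉B y∈B y∉D) (separated-edge eC₁A c∈C₁ c∉A y∈A y∉C₁)
    by-cases (yes y∈C₁) (yes y∈C₂) _ =
      three-neighbours eBA eC₁A eC₂A B≢C₁ B≢C₂ C₁≢C₂ y∈A y∈B y∈C₁ y∈C₂
    by-cases (yes _) (no y∉C₂) (yes u∈D) =
      no-claw (adjacent (source-max eDB) u∈D d∈D u∈B d∉B)
              (adjacent (source-max eC₂A) u∈C₂ q∈C₂ u∈A q∉A)
              (adjacent (target-max eDB) u∈B y∈B u∈D y∉D)
        (separated-across eDB eBA eC₂A D≢A (≢-sym B≢C₂) d∈D d∉B q∈C₂ q∉A)
        (separated-edge eDB d∈D d∉B y∈B y∉D) (separated-edge eC₂A q∈C₂ q∉A y∈A y∉C₂)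
    by-cases (yes _) (no _) (no u∉D) =
      no-claw vd vc (adjacent (target-max eBA) v∈A u∈A v∈C₁ u∉C₁)
        d-c (separated-edge eDB d∈D d∉B u∈B u∉D) (separated-edge eC₁A c∈C₁ c∉A u∈A u∉C₁)

  OneOf : Subset n → Subset n → Subset n → Subset n → Set
  OneOf X P Q R = X ≡ P ⊎ X ≡ Q ⊎ X ≡ R

  -- No tree edge D–X
  -- of T[𝓜_v] enters {A', A, A_P} from outside: X = A gives three neighbours of
  -- A containing v, while X = A' (with u = w) and X = A_P (with u a private
  -- vertex of A against A') are instances of the prolonged claw.
  fork-no-entry : ∀ {v w A' A AP AQ D X} → IsFork TE v w A' A AP AQ →
                  TE D X → v ∈ D → ¬ OneOf D A' A AP → OneOf X A' A AP → ⊥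
  fork-no-entry {v = v} {A' = A'} {A} {AP} {AQ} {D}
    ((v∈A' , v∈A , v∈AP , eA'A , eAAP , A'≢AP , _) , (w∈A' , w∈A , w∈AQ , _ , eAAQ , A'≢AQ , _) , w∉AP , v∉AQ)
    e v∈D D∉ X∈ = entering e X∈
    where
    AP≢AQ : AP ≢ AQ
    AP≢AQ AP≡AQ = v∉AQ (subst (v ∈_) AP≡AQ v∈AP)
    D≢A' : D ≢ A'
    D≢A' D≡A' = D∉ (inj₁ D≡A')
    D≢A : D ≢ A
    D≢A D≡A = D∉ (inj₂ (inj₁ D≡A))
    D≢AP : D ≢ AP
    D≢AP D≡AP = D∉ (inj₂ (inj₂ D≡AP))
    entering : ∀ {X} → TE D X → OneOf X A' A AP → ⊥
    entering e (inj₁ refl) =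
      prolonged-claw e eA'A (edge-sym eAAP) (edge-sym eAAQ) D≢A A'≢AP A'≢AQ AP≢AQ
        v∈D v∈A' v∈A v∈AP w∈A' w∈A w∈AQ w∉AP
    entering e (inj₂ (inj₁ refl)) =
      three-neighbours eA'A (edge-sym eAAP) e A'≢AP (≢-sym D≢A') (≢-sym D≢AP) v∈A v∈A' v∈AP v∈D
    entering e (inj₂ (inj₂ refl)) with private-vertex (edge-sym eA'A)
    ... | a , a∈A , a∉A' =
      prolonged-claw e (edge-sym eAAP) eA'A (edge-sym eAAQ) D≢A (≢-sym A'≢AP) AP≢AQ A'≢AQ
        v∈D v∈AP v∈A v∈A' a∈AP a∈A a∈AQ a∉A'
      where
      a∈AP : a ∈ AP
      a∈AP = middle-covered eA'A eAAP A'≢AP v∈A' v∈A v∈AP a∈A a∉A'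
      a∈AQ : a ∈ AQ
      a∈AQ = middle-covered eA'A eAAQ A'≢AQ w∈A' w∈A w∈AQ a∈A a∉A'

  -- Hence A', A, A_P are the only max cliques containing v: from any other one,
  -- the path of T[𝓜_v] to A would have to enter {A', A, A_P}.
  fork-exactly-three : ∀ {v w A' A AP AQ} → IsFork TE v w A' A AP AQ → ExactlyThreeMaxCliques G v
  fork-exactly-three {v = v} {A' = A'} {A} {AP} fork@((v∈A' , v∈A , v∈AP , eA'A , eAAP , A'≢AP , _) , _) =
    A' , A , AP , source-max eA'A , target-max eA'A , target-max eAAP ,
    v∈A' , v∈A , v∈AP , edge-≢ eA'A , A'≢AP , edge-≢ eAAP , only-these
    where
    one-of? : Decidable (λ X → OneOf X A' A AP)
    one-of? X = (X ≟S A') ⊎-dec ((X ≟S A) ⊎-dec (X ≟S AP))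
    only-these : ∀ D → MaxClique G D → v ∈ D → OneOf D A' A AP
    only-these D D-max v∈D with one-of? D
    ... | yes D∈ = D∈
    ... | no D∉ with crossing one-of? (subtree v D A D-max (target-max eA'A) v∈D v∈A) D∉ (inj₂ (inj₁ refl))
    ... | _ , _ , (e , v∈D' , _) , D'∉ , X∈ = ⊥-elim (fork-no-entry fork e v∈D' D'∉ X∈)

lemma3p9 : ∀ {n : ℕ} (G : Graph n) → Connected G → Chordal G → ClawFree G →
    (TE : Subset n → Subset n → Set) → IsCliqueTree G TE →
    (v w : Fin n) → Fork TE v w →
    ExactlyThreeMaxCliques G v × ExactlyThreeMaxCliques G w
lemma3p9 G _ _ claw-free TE ct v w (_ , _ , _ , _ , v-path , w-path , w∉AP , v∉AQ) =
  fork-exactly-three (v-path , w-path , w∉AP , v∉AQ) , fork-exactly-three (w-path , v-path , v∉AQ , w∉AP)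
  where open ClawFreeCliqueTree ct claw-free
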